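{- Let $n\ge1$ and $m\ge 2^n$ be integers, and consider a play of the game described in the context, in which Kronecker uses the ``0 first'' strategy and Cantor queries the entries in an arbitrary (adaptive) order until all $mn$ entries are queried. Let $L_t$ denote the state matrix after $t$ queries. If $L_t$ is unblocked then $L_{t+1}$ is unblocked. Hence $L_{mn}$ is complete, i.e. the set of rows of $L_{mn}$ contains every vector of $\{0,1\}^n$.
   Context: Kronecker holds $v_1,\ldots,v_m\in\{0,1\}^n$; Cantor queries entries ``bit $j$ of vector $i$''. The state is an $m\times n$ matrix $L$ over $\{0,1,\star\}$, where $L(i,j)=\star$ means bit $j$ of $v_i$ is not yet queried and otherwise it is Kronecker's answer; $L_0$ is all $\star$, and each query is to a $\star$ entry. A set $S$ of $2^n$ rows of $L$ is useful if, after replacing each $\star$ in $S$ by $0$ or $1$ suitably, the rows of $S$ are exactly the $2^n$ distinct vectors of $\{0,1\}^n$. $L$ is unblocked if it has a useful set of rows, and blocked otherwise. The ``0 first'' strategy: when entry $(i,j)$ is queried, Kronecker answers $1$ if setting $L(i,j)$ to $0$ would make $L$ blocked, and $0$ otherwise. -}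

module Defs where

open import Data.Nat using (ℕ; suc; _*_; _<_)
open import Data.Bool using (Bool; true; false; _∧_; if_then_else_)
open import Data.Maybe using (Maybe; just; nothing)
open import Data.Fin using (Fin; _≟_)
open import Data.Fin.Subset using (Subset; _∈_; ∣_∣)
open import Data.Product using (Σ; ∃; ∃-syntax; _×_; _,_)
open import Data.Sum using (_⊎_)
open import Relation.Nullary using (¬_; does)
open import Relation.Binary.PropositionalEquality using (_≡_; _≢_)
open import Data.Nat using (_^_)

-- An entry: nothing = ⋆ (not yet queried), just b = Kronecker's answer b
-- (false = 0, true = 1).
Entry : Set
Entry = Maybe Bool

Matrix : ℕ → ℕ → Set
Matrix m n = Fin m → Fin n → Entry

BVec : ℕ → Set
BVec n = Fin n → Bool

FillsRow : ∀ {m n} → Matrix m n → (Fin m → BVec n) → Fin m → Set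
FillsRow L c i = ∀ j b → L i j ≡ just b → c i j ≡ b

Useful : ∀ {m n} → Matrix m n → Subset m → Set
Useful {m} {n} L S =
  ∣ S ∣ ≡ 2 ^ n ×
  Σ (Fin m → BVec n) λ c →
      (∀ i → i ∈ S → FillsRow L c i)
    × (∀ i i′ → i ∈ S → i′ ∈ S → i ≢ i′ → ¬ (∀ j → c i j ≡ c i′ j))
    × (∀ (v : BVec n) → ∃[ i ] (i ∈ S × (∀ j → c i j ≡ v j)))

Unblocked : ∀ {m n} → Matrix m n → Set
Unblocked {m} L = ∃[ S ] Useful L S

Blocked : ∀ {m n} → Matrix m n → Set
Blocked L = ¬ Unblocked L

update : ∀ {m n} → Matrix m n → Fin m → Fin n → Entry → Matrix m n
update L i j x i′ j′ = if does (i′ ≟ i) ∧ does (j′ ≟ j) then x else L i′ j′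

ZeroFirstAnswer : ∀ {m n} → Matrix m n → Fin m → Fin n → Bool → Set
ZeroFirstAnswer L i j b =
    (b ≡ true  × Blocked (update L i j (just false)))
  ⊎ (b ≡ false × ¬ Blocked (update L i j (just false)))

ZeroFirstStep : ∀ {m n} → Matrix m n → Matrix m n → Set
ZeroFirstStep {m} {n} L L′ =
  Σ (Fin m) λ i → Σ (Fin n) λ j →
    L i j ≡ nothing ×
    Σ Bool λ b → ZeroFirstAnswer L i j b ×
      (∀ i′ j′ → L′ i′ j′ ≡ update L i j (just b) i′ j′)

Complete : ∀ {m n} → Matrix m n → Set
Complete {m} {n} L = ∀ (v : BVec n) → ∃[ i ] (∀ j → L i j ≡ just (v j))

{-# OPTIONS --safe #-}

-- A useful set survives every answer that agrees with its filling.  "0 first"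
-- answers 1 only if answering 0 leaves no useful set, so no useful set can
-- have 0 filled in at the queried entry of one of its rows, and every useful
-- set survives the answer 1.  Initially the first 2^n rows, filled with the
-- 2^n binary vectors, are useful.  Each query replaces a ⋆, so after mn queries
-- none is left and a surviving useful set consists of actual rows, which cover
-- {0,1}^n.  As blocked is a negation, the answer-0 case uses that
-- unblockedness is decidable by exhaustive search.

module Submission where

open import Defs
open import Data.Nat as ℕ using (ℕ; zero; suc; _*_; _^_; _≤_; _<_; z≤n; s≤s; _≤′_; ≤′-refl; ≤′-step)
open import Data.Nat.Properties using (≤-refl; ≤-antisym; ≮⇒≥; <⇒≤; <-≤-trans; n<1+n; ≤⇒≤′)
open import Data.Bool as Bool using (Bool; true; false)
open import Data.Maybe using (just; nothing)
open import Data.Maybe.Properties using (just-injective)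
open import Data.Fin as Fin using (Fin; zero; suc; toℕ; lower; inject≤; combine; remQuot; finToFun; funToFin; _≟_)
open import Data.Fin.Properties
  using (any?; all?; 2↔Bool; lower-injective; toℕ-inject≤; toℕ<n; remQuot-combine;
         finToFun-funToFin; funToFin-finToFin; pigeonhole; combine-injective)
open import Data.Fin.Subset using (Subset; _∈_; ∣_∣; ⊥; inside)
open import Data.Fin.Subset.Properties using (_∈?_; anySubset?; ∉⊥; ∣⊥∣≡0)
open import Data.Vec using (_∷_; here; there; lookup; tabulate)
open import Data.Vec.Properties using (lookup∘tabulate)
open import Data.Product using (Σ; ∃; ∃₂; ∃-syntax; _×_; _,_; proj₁; proj₂; uncurry)
open import Data.Product.Properties using (×-≡,≡→≡)
open import Data.Sum using (_⊎_; inj₁; inj₂)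
import Data.Empty as Empty
open import Function using (_∘_)
open import Function.Bundles using (Inverse)
open import Relation.Nullary using (Dec; yes; no; ¬_)
open import Relation.Nullary.Decidable using (map′; decidable-stable; ¬?; _×-dec_; _→-dec_)
open import Relation.Unary using (Decidable)
open import Relation.Binary.PropositionalEquality

private
  variable
    k m n : ℕ

anyVector? : {P : BVec k → Set} → (∀ {v w} → v ≗ w → P v → P w) →
             Decidable P → Dec (∃ P)
anyVector? resp P? = map′
  (λ (s , p) → lookup s , p)
  (λ (v , p) → tabulate v , resp (sym ∘ lookup∘tabulate v) p)
  (anySubset? (P? ∘ lookup))

allVectors? : {P : BVec k → Set} → (∀ {v w} → v ≗ w → P v → P w) →
              Decidable P → Dec (∀ v → P v)
allVectors? resp P? with anyVector? (λ v≗w ¬p → ¬p ∘ resp (sym ∘ v≗w)) (¬? ∘ P?)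
... | yes (v , ¬p) = no λ all → ¬p (all v)
... | no ¬∃ = yes λ v → decidable-stable (P? v) λ ¬p → ¬∃ (v , ¬p)

anyFilling? : {P : (Fin m → BVec n) → Set} → (∀ {c d} → (∀ i → c i ≗ d i) → P c → P d) →
              Decidable P → Dec (∃ P)
anyFilling? {m} {n} resp P? = map′
  (λ (v , p) → curried v , p)
  (λ (c , p) → uncurry c ∘ remQuot n , resp (λ i j → cong (uncurry c) (sym (remQuot-combine i j))) p)
  (anyVector? (λ v≗w → resp (λ i j → v≗w (combine i j))) (P? ∘ curried))
  where
  curried : BVec (m * n) → Fin m → BVec n
  curried v i j = v (combine i j)

Distinct : Subset m → (Fin m → BVec n) → Set
Distinct S c = ∀ i i′ → i ∈ S → i′ ∈ S → i ≢ i′ → ¬ (∀ j → c i j ≡ c i′ j)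

Covers : Subset m → (Fin m → BVec n) → BVec n → Set
Covers S c v = ∃[ i ] (i ∈ S × (∀ j → c i j ≡ v j))

UsefulFilling : Matrix m n → Subset m → (Fin m → BVec n) → Set
UsefulFilling L S c = (∀ i → i ∈ S → FillsRow L c i) × Distinct S c × (∀ v → Covers S c v)

fillsRow? : (L : Matrix m n) (c : Fin m → BVec n) (i : Fin m) → Dec (FillsRow L c i)
fillsRow? L c i = all? λ j → agrees? (L i j) (c i j)
  where
  agrees? : (e : Entry) (x : Bool) → Dec (∀ b → e ≡ just b → x ≡ b)
  agrees? nothing  x = yes λ _ ()
  agrees? (just b) x = map′ (λ { x≡b _ refl → x≡b }) (λ agree → agree b refl) (x Bool.≟ b)

distinct? : (S : Subset m) (c : Fin m → BVec n) → Dec (Distinct S c)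
distinct? S c = all? λ i → all? λ i′ →
  (i ∈? S) →-dec (i′ ∈? S) →-dec ¬? (i ≟ i′) →-dec ¬? (all? λ j → c i j Bool.≟ c i′ j)

covers? : (S : Subset m) (c : Fin m → BVec n) → Decidable (Covers S c)
covers? S c v = map′ (λ (i , p , q) → i , p , q) (λ (i , p , q) → i , p , q)
  (any? λ i → (i ∈? S) ×-dec all? λ j → c i j Bool.≟ v j)

usefulFilling? : (L : Matrix m n) (S : Subset m) → Decidable (UsefulFilling L S)
usefulFilling? L S c =
  (all? λ i → (i ∈? S) →-dec fillsRow? L c i) ×-dec
  distinct? S c ×-dec
  allVectors? (λ v≗w (i , i∈S , same) → i , i∈S , λ j → trans (same j) (v≗w j)) (covers? S c)

usefulFilling-resp : {L : Matrix m n} {S : Subset m} {c d : Fin m → BVec n} →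
                     (∀ i → c i ≗ d i) → UsefulFilling L S c → UsefulFilling L S d
usefulFilling-resp c≗d (fills , distinct , covers) =
  (λ i i∈S j b Lij≡b → trans (sym (c≗d i j)) (fills i i∈S j b Lij≡b)) ,
  (λ i i′ i∈S i′∈S i≢i′ same → distinct i i′ i∈S i′∈S i≢i′ λ j →
     trans (c≗d i j) (trans (same j) (sym (c≗d i′ j)))) ,
  λ v → let i , i∈S , same = covers v in i , i∈S , λ j → trans (sym (c≗d i j)) (same j)

unblocked? : (L : Matrix m n) → Dec (Unblocked L)
unblocked? {n = n} L = anySubset? λ S →
  (∣ S ∣ ℕ.≟ 2 ^ n) ×-dec anyFilling? usefulFilling-resp (usefulFilling? L S)

unblocked-resp : {L L′ : Matrix m n} → (∀ i j → L′ i j ≡ L i j) → Unblocked L → Unblocked L′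
unblocked-resp L′≡L (S , size , c , fills , distinct , covers) =
  S , size , c , (λ i i∈S j b L′ij≡b → fills i i∈S j b (trans (sym (L′≡L i j)) L′ij≡b)) , distinct , covers

update-view : (L : Matrix m n) (i : Fin m) (j : Fin n) (x : Entry) (i′ : Fin m) (j′ : Fin n) →
              (i′ ≡ i × j′ ≡ j × update L i j x i′ j′ ≡ x) ⊎
              (¬ (i′ ≡ i × j′ ≡ j) × update L i j x i′ j′ ≡ L i′ j′)
update-view L i j x i′ j′ with i′ ≟ i | j′ ≟ j
... | yes i′≡i | yes j′≡j = inj₁ (i′≡i , j′≡j , refl)
... | yes _    | no j′≢j  = inj₂ (j′≢j ∘ proj₂ , refl)
... | no i′≢i  | _        = inj₂ (i′≢i ∘ proj₁ , refl)

usefulFilling-update : {L : Matrix m n} {S : Subset m} {c : Fin m → BVec n}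
                       {i : Fin m} {j : Fin n} {b : Bool} →
                       UsefulFilling L S c → (i ∈ S → c i j ≡ b) →
                       UsefulFilling (update L i j (just b)) S c
usefulFilling-update {L = L} {S} {c} {i} {j} {b} (fills , distinct , covers) agree =
  fills′ , distinct , covers
  where
  fills′ : ∀ i′ → i′ ∈ S → FillsRow (update L i j (just b)) c i′
  fills′ i′ i′∈S j′ b′ updated≡b′ with update-view L i j (just b) i′ j′
  ... | inj₁ (refl , refl , updated≡b) = trans (agree i′∈S) (just-injective (trans (sym updated≡b) updated≡b′))
  ... | inj₂ (_ , updated≡L) = fills i′ i′∈S j′ b′ (trans (sym updated≡L) updated≡b′)

zeroFirstStep-preserves-unblocked : {L L′ : Matrix m n} → ZeroFirstStep L L′ → Unblocked L → Unblocked L′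
zeroFirstStep-preserves-unblocked {L = L} (i , j , _ , _ , inj₂ (refl , ¬blocked) , L′≡) _ =
  unblocked-resp L′≡ (decidable-stable (unblocked? (update L i j (just false))) ¬blocked)
zeroFirstStep-preserves-unblocked {L = L} (i , j , _ , _ , inj₁ (refl , blocked) , L′≡) (S , size , c , useful) =
  unblocked-resp L′≡ (S , size , c , usefulFilling-update useful agree)
  where
  agree : i ∈ S → c i j ≡ true
  agree i∈S with c i j in cij≡
  ... | true  = refl
  ... | false = Empty.⊥-elim (blocked (S , size , c , usefulFilling-update useful λ _ → cij≡))

initialSegment : ∀ k → k ≤ m →
                 Σ (Subset m) λ S → ∣ S ∣ ≡ k × (∀ {i} → i ∈ S → toℕ i < k) × (∀ {i} → toℕ i < k → i ∈ S)
initialSegment {m} zero _ = ⊥ , ∣⊥∣≡0 m , (λ i∈⊥ → Empty.⊥-elim (∉⊥ i∈⊥)) , λ ()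
initialSegment (suc k) (s≤s k≤m) with initialSegment k k≤m
... | S , size , below , contains =
  inside ∷ S , cong suc size ,
  (λ { {zero} _ → s≤s z≤n ; {suc i} (there i∈S) → s≤s (below i∈S) }) ,
  (λ { {zero} _ → here ; {suc i} (s≤s i<k) → there (contains i<k) })

lower-inject≤ : (x : Fin k) (k≤m : k ≤ m) .(x<k : toℕ (inject≤ x k≤m) < k) →
                lower (inject≤ x k≤m) x<k ≡ x
lower-inject≤ zero    (s≤s _)   _ = refl
lower-inject≤ (suc x) (s≤s k≤m) _ = cong suc (lower-inject≤ x k≤m _)

funToFin-cong : {f g : Fin m → Fin n} → f ≗ g → funToFin f ≡ funToFin g
funToFin-cong {zero}  f≗g = refl
funToFin-cong {suc m} f≗g = cong₂ combine (f≗g zero) (funToFin-cong (f≗g ∘ suc))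

module _ where
  open Inverse 2↔Bool using (to; from; strictlyInverseˡ; strictlyInverseʳ)

  binary : (n : ℕ) → Fin (2 ^ n) → BVec n
  binary n x = to ∘ finToFun {2} {n} x

  fromBinary : BVec n → Fin (2 ^ n)
  fromBinary v = funToFin (from ∘ v)

  binary-fromBinary : (v : BVec n) → binary n (fromBinary v) ≗ v
  binary-fromBinary v j = trans (cong to (finToFun-funToFin (from ∘ v) j)) (strictlyInverseˡ (v j))

  fromBinary-binary : (x : Fin (2 ^ n)) → fromBinary (binary n x) ≡ x
  fromBinary-binary {n} x =
    trans (funToFin-cong (strictlyInverseʳ ∘ finToFun {2} {n} x)) (funToFin-finToFin {n} {2} x)

  binary-injective : {x y : Fin (2 ^ n)} → binary n x ≗ binary n y → x ≡ y
  binary-injective {n} {x} {y} bx≗by = begin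
    x                       ≡⟨ fromBinary-binary {n} x ⟨
    fromBinary (binary n x) ≡⟨ funToFin-cong (cong from ∘ bx≗by) ⟩
    fromBinary (binary n y) ≡⟨ fromBinary-binary {n} y ⟩
    y                       ∎
    where open ≡-Reasoning

rowCode : Fin m → BVec n
rowCode {n = n} i with toℕ i ℕ.<? 2 ^ n
... | yes i<2ⁿ = binary n (lower i i<2ⁿ)
... | no _     = λ _ → false

rowCode-below : (i : Fin m) (i<2ⁿ : toℕ i < 2 ^ n) → rowCode i ≗ binary n (lower i i<2ⁿ)
rowCode-below {n = n} i i<2ⁿ with toℕ i ℕ.<? 2 ^ n
... | yes _   = λ _ → refl
... | no i≮2ⁿ = Empty.⊥-elim (i≮2ⁿ i<2ⁿ)

unqueried-unblocked : 2 ^ n ≤ m → (L : Matrix m n) → (∀ i j → L i j ≡ nothing) → Unblocked L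
unqueried-unblocked {n} {m} 2ⁿ≤m L unqueried with initialSegment (2 ^ n) 2ⁿ≤m
... | S , size , below , contains = S , size , rowCode , fills , distinct , covers
  where
  fills : ∀ i → i ∈ S → FillsRow L rowCode i
  fills i _ j b Lij≡b with () ← trans (sym (unqueried i j)) Lij≡b

  distinct : Distinct S rowCode
  distinct i i′ i∈S i′∈S i≢i′ same = i≢i′ (lower-injective i i′ (binary-injective λ j →
    trans (sym (rowCode-below {n = n} i (below i∈S) j)) (trans (same j) (rowCode-below {n = n} i′ (below i′∈S) j))))

  covers : ∀ v → Covers S rowCode v
  covers v = i , contains i<2ⁿ , λ j → begin
    rowCode i j                     ≡⟨ rowCode-below {n = n} i i<2ⁿ j ⟩
    binary n (lower i i<2ⁿ) j       ≡⟨ cong (λ x → binary n x j) (lower-inject≤ (fromBinary v) 2ⁿ≤m i<2ⁿ) ⟩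
    binary n (fromBinary v) j       ≡⟨ binary-fromBinary v j ⟩
    v j                             ∎
    where
    open ≡-Reasoning
    i : Fin m
    i = inject≤ (fromBinary v) 2ⁿ≤m
    i<2ⁿ : toℕ i < 2 ^ n
    i<2ⁿ = subst (_< 2 ^ n) (sym (toℕ-inject≤ (fromBinary v) 2ⁿ≤m)) (toℕ<n (fromBinary v))

Unqueried : Matrix m n → Fin m × Fin n → Set
Unqueried L (i , j) = L i j ≡ nothing

QueryStep : Matrix m n → Matrix m n → Set
QueryStep L L′ =
  (∃[ x ] (Unqueried L x × ¬ Unqueried L′ x)) × (∀ x → Unqueried L′ x → Unqueried L x)

zeroFirstStep-queryStep : {L L′ : Matrix m n} → ZeroFirstStep L L′ → QueryStep L L′
zeroFirstStep-queryStep {L = L} {L′} (i , j , unqueried , b , _ , L′≡) =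
  ((i , j) , unqueried , answered) , earlier
  where
  answered : ¬ L′ i j ≡ nothing
  answered L′ij≡nothing with update-view L i j (just b) i j
  ... | inj₁ (_ , _ , updated≡b) with () ← trans (sym updated≡b) (trans (sym (L′≡ i j)) L′ij≡nothing)
  ... | inj₂ (different , _) = different (refl , refl)

  earlier : ∀ x → Unqueried L′ x → Unqueried L x
  earlier (i′ , j′) L′≡nothing with update-view L i j (just b) i′ j′
  ... | inj₁ (refl , refl , _) = unqueried
  ... | inj₂ (_ , updated≡L) = trans (sym updated≡L) (trans (sym (L′≡ i′ j′)) L′≡nothing)

module _ (L : ℕ → Matrix m n) (run : ∀ t → t < m * n → QueryStep (L t) (L (suc t))) where

  unqueried-earlier : ∀ {s t} x → s ≤′ t → t ≤ m * n → Unqueried (L t) x → Unqueried (L s) x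
  unqueried-earlier x ≤′-refl        _      unqueried = unqueried
  unqueried-earlier x (≤′-step s≤′t) 1+t≤mn unqueried =
    unqueried-earlier x s≤′t (<⇒≤ 1+t≤mn) (proj₂ (run _ 1+t≤mn) x unqueried)

  -- Each of the mn steps queries a cell that stays queried; a cell still
  -- unqueried at the end would be an (mn+1)-st cell, contradicting pigeonhole.
  run-queries-all : ∀ x → ¬ Unqueried (L (m * n)) x
  run-queries-all x x-unqueried = noRepeatedCell (pigeonhole (n<1+n (m * n)) (uncurry combine ∘ cell ∘ toℕ))
    where
    cell : ℕ → Fin m × Fin n
    cell t with t ℕ.<? m * n
    ... | yes t<mn = proj₁ (proj₁ (run t t<mn))
    ... | no _     = x

    unqueried-at : ∀ t → t ≤ m * n → Unqueried (L t) (cell t)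
    unqueried-at t t≤mn with t ℕ.<? m * n
    ... | yes t<mn = proj₁ (proj₂ (proj₁ (run t t<mn)))
    ... | no t≮mn = subst (λ t → Unqueried (L t) x) (sym (≤-antisym t≤mn (≮⇒≥ t≮mn))) x-unqueried

    queried-later : ∀ s t → s < t → t ≤ m * n → ¬ Unqueried (L t) (cell s)
    queried-later s t s<t t≤mn unqueried with s ℕ.<? m * n
    ... | yes s<mn = proj₂ (proj₂ (proj₁ (run s s<mn))) (unqueried-earlier _ (≤⇒≤′ s<t) t≤mn unqueried)
    ... | no s≮mn  = s≮mn (<-≤-trans s<t t≤mn)

    noRepeatedCell : ¬ ∃₂ λ s t → s Fin.< t × uncurry combine (cell (toℕ s)) ≡ uncurry combine (cell (toℕ t))
    noRepeatedCell (s , t , s<t , same) = queried-later (toℕ s) (toℕ t) s<t t≤mn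
      (subst (Unqueried (L (toℕ t))) (sym (×-≡,≡→≡ (combine-injective _ _ _ _ same)))
        (unqueried-at (toℕ t) t≤mn))
      where
      t≤mn : toℕ t ≤ m * n
      t≤mn = ℕ.s≤s⁻¹ (toℕ<n t)

unblocked-queried-complete : {L : Matrix m n} → Unblocked L → (∀ i j → L i j ≢ nothing) → Complete L
unblocked-queried-complete {L = L} (S , _ , c , fills , _ , covers) queried v
  with i , i∈S , ci≗v ← covers v = i , entry
  where
  entry : ∀ j → L i j ≡ just (v j)
  entry j with L i j in Lij≡
  ... | nothing = Empty.⊥-elim (queried i j Lij≡)
  ... | just b  = cong just (trans (sym (fills i i∈S j b Lij≡)) (ci≗v j))

mainTheorem5 : (n m : ℕ) → 1 ≤ n → 2 ^ n ≤ m →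
    (L : ℕ → Matrix m n) →
    (∀ i j → L 0 i j ≡ nothing) →
    (∀ t → t < m * n → ZeroFirstStep (L t) (L (suc t))) →
    (∀ t → t < m * n → Unblocked (L t) → Unblocked (L (suc t)))
      × Complete (L (m * n))
mainTheorem5 n m _ 2ⁿ≤m L L₀ steps =
  preserves , unblocked-queried-complete (unblocked (m * n) ≤-refl) queried
  where
  preserves : ∀ t → t < m * n → Unblocked (L t) → Unblocked (L (suc t))
  preserves t t<mn = zeroFirstStep-preserves-unblocked (steps t t<mn)

  unblocked : ∀ t → t ≤ m * n → Unblocked (L t)
  unblocked zero    _    = unqueried-unblocked 2ⁿ≤m (L 0) L₀
  unblocked (suc t) t<mn = preserves t t<mn (unblocked t (<⇒≤ t<mn))

  queried : ∀ i j → L (m * n) i j ≢ nothing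
  queried i j = run-queries-all L (λ t t<mn → zeroFirstStep-queryStep (steps t t<mn)) (i , j)
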